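{- In the distributed file-bundle caching problem with $m=l+1$ identical caches, each of size $k$, and queries of length $l$, there is a deterministic online distributed caching algorithm with competitive ratio $l^2+l$ with respect to the optimal offline algorithm using a single cache of size $k$.
   Context: Pages $\mathcal{O}=\{1,\dots,N\}$. Distributed file-bundle caching: there are $m$ caches, the contents at time $t$ being $C_t=\{C_t^i\}_{i=1}^m$ with $C_t^i\subset\mathcal{O}$, $|C_t^i|=k$. At each time $t$ a query $Q_t\subset\mathcal{O}$ with $|Q_t|=l$ arrives; the cost is $f(C_t,Q_t)=\prod_{i=1}^m\mathbb{1}_{\{Q_t\not\subseteq C_t^i\}}$ (a miss occurs iff no single cache contains the whole query); the cache contents are updated between queries, without knowledge of future queries. The total cost on $\sigma=\{Q_t\}_{t=1}^T$ is $\mathrm{ALG}(\sigma)=\sum_t f(C_t,Q_t)$. The benchmark $\mathrm{OPT}(\sigma)$ is the number of misses of the optimal offline algorithm for the single-cache file-bundle caching problem with one cache of size $k$ (where a miss at time $t$ means $Q_t\not\subseteq C_t$, and upon a miss the cache must insert $Q_t$ by evicting pages, with no other changes allowed). Competitive ratio $r$: $\mathrm{ALG}(\sigma)\le r\,\mathrm{OPT}(\sigma)+c$ for all $\sigma$, with $c$ independent of $\sigma$. -}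

module Defs where

open import Data.Nat using (ℕ; zero; suc; _+_; _*_; _≤_)
open import Data.Fin using (Fin; zero; suc)
open import Data.Fin.Subset using (Subset; _⊆_; _∪_; ∣_∣)
open import Data.Fin.Subset.Properties using (_⊆?_)
open import Data.Product using (Σ; _,_; proj₁)
open import Data.List using (List; []; _∷_)
open import Data.Bool using (if_then_else_)
open import Relation.Nullary using (¬_; does)
open import Relation.Binary.PropositionalEquality using (_≡_)

SizedSet : (N s : ℕ) → Set
SizedSet N s = Σ (Subset N) (λ A → ∣ A ∣ ≡ s)

Query : (N l : ℕ) → Set
Query N l = SizedSet N l

Cache : (N k : ℕ) → Set
Cache N k = SizedSet N k

Config : (N k m : ℕ) → Set
Config N k m = Fin m → Cache N k

notIn : {N l k : ℕ} → Query N l → Cache N k → ℕ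
notIn Q C = if does (proj₁ Q ⊆? proj₁ C) then 0 else 1

prodFin : (m : ℕ) → (Fin m → ℕ) → ℕ
prodFin zero    f = 1
prodFin (suc m) f = f zero * prodFin m (λ i → f (suc i))

cost : {N l k m : ℕ} → Config N k m → Query N l → ℕ
cost {m = m} C Q = prodFin m (λ i → notIn Q (C i))

-- A deterministic online distributed algorithm: maps the history of past
-- queries (most recent first) to the cache contents used for the next query.
-- C_1 = A [], C_{t+1} = A (Q_t ∷ … ∷ Q_1).
OnlineAlg : (N l k m : ℕ) → Set
OnlineAlg N l k m = List (Query N l) → Config N k m

algCostFrom : {N l k m : ℕ} → OnlineAlg N l k m → List (Query N l) → List (Query N l) → ℕ
algCostFrom A hist []       = 0
algCostFrom A hist (Q ∷ σ)  = cost (A hist) Q + algCostFrom A (Q ∷ hist) σ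

algCost : {N l k m : ℕ} → OnlineAlg N l k m → List (Query N l) → ℕ
algCost A σ = algCostFrom A [] σ

-- Valid runs of the single-cache (size k) file-bundle caching problem.
-- SingleRun D σ n : starting with cache contents D, serving σ legally
-- incurs exactly n misses.
data SingleRun {N l k : ℕ} : Cache N k → List (Query N l) → ℕ → Set where
  done : ∀ {D : Cache N k} → SingleRun {N} {l} D [] 0
  hit  : ∀ {D : Cache N k} {Q : Query N l} {σ n} → proj₁ Q ⊆ proj₁ D → SingleRun D σ n → SingleRun D (Q ∷ σ) n
  miss : ∀ {D D' : Cache N k} {Q : Query N l} {σ n} → ¬ (proj₁ Q ⊆ proj₁ D) → proj₁ Q ⊆ proj₁ D' →
         proj₁ D' ⊆ (proj₁ D ∪ proj₁ Q) → SingleRun D' σ n → SingleRun D (Q ∷ σ) (suc n)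

-- The algorithm works in phases, with d = ⌊k/l⌋ and W = k + d. The phase set S collects
-- the pages requested since the phase began; when adding a query Q would make |S| exceed W,
-- a new phase starts with S = Q. The l + 1 caches hold S minus one of l + 1 disjoint
-- blocks of at most d pages each, so each has at most k pages, and a query Q ⊆ S of l pages
-- meets at most l blocks and is a hit. Hence every miss adds a page to S, and a phase costs
-- at most W misses. If the single cache misses J times during a completed phase, all pages
-- of S ∪ Q were either in its initial contents or inserted by those misses, so
-- k + d < |S ∪ Q| ≤ k + l J; then d < l J gives W ≤ (l² + l) J. The unfinished last phase
-- costs at most W, the additive constant.

module Submission where

open import Defs
open import Data.Nat using (ℕ; zero; suc; _+_; _*_; _∸_; _≤_; _<_; z≤n; s≤s; _≤?_)
open import Data.Nat.Properties
open import Data.Nat.DivMod using (_/_; _%_; m≡m%n+[m/n]*n; m%n<n; m/n*n≤m)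
open import Data.Nat.Tactic.RingSolver using (solve-∀)
open import Data.Fin using (Fin; zero; suc)
open import Data.Fin.Subset
  using (Subset; _⊆_; _∪_; _∩_; _─_; ∣_∣; ⊥; inside; outside; _∈_; _∉_)
open import Data.Fin.Subset.Properties
  using (_⊆?_; _∈?_; out⊆; in⊆in; ⊆-refl; ⊆-trans; ⊥⊆; ∣⊥∣≡0; ∣p∣≤n; ∣p∣≤∣x∷p∣; ∣p∣≤∣p∪q∣;
         p⊆q⇒∣p∣≤∣q∣; p⊆p∪q; q⊆p∪q; x∈p∪q⁻; x∈p∩q⁺; nonempty?;
         x∈p∧x∉q⇒x∈p─q; p∩q≢∅⇒∣p─q∣<∣p∣)
open import Data.Vec using (_∷_; [])
open import Data.Vec.Base using (here; there)
open import Data.Product using (Σ; ∃-syntax; _,_; proj₁; proj₂; _×_)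
open import Data.Sum using (_⊎_; inj₁; inj₂)
open import Data.List using (List; []; _∷_)
open import Function using (_$_)
open import Relation.Nullary using (yes; no; contradiction)
open import Relation.Nullary.Decidable using (dec-true)
open import Relation.Binary.PropositionalEquality using (_≡_; refl; sym; cong; subst; subst₂)

x∈p─q⁻ : ∀ {n} (p q : Subset n) {x} → x ∈ p ─ q → x ∈ p × x ∉ q
x∈p─q⁻ (inside ∷ p) (outside ∷ q) here = here , λ ()
x∈p─q⁻ (inside ∷ p) (inside ∷ q) {zero} ()
x∈p─q⁻ (outside ∷ p) (inside ∷ q) {zero} ()
x∈p─q⁻ (outside ∷ p) (outside ∷ q) {zero} ()
x∈p─q⁻ (_ ∷ p) (_ ∷ q) (there x∈) with x∈p─q⁻ p q x∈
... | x∈p , x∉q = there x∈p , λ { (there x∈q) → x∉q x∈q }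

∪-least : ∀ {n} {p q r : Subset n} → p ⊆ r → q ⊆ r → p ∪ q ⊆ r
∪-least {p = p} {q} p⊆r q⊆r x∈ with x∈p∪q⁻ p q x∈
... | inj₁ x∈p = p⊆r x∈p
... | inj₂ x∈q = q⊆r x∈q

∪-mono : ∀ {n} {p p′ q q′ : Subset n} → p ⊆ p′ → q ⊆ q′ → p ∪ q ⊆ p′ ∪ q′
∪-mono {q′ = q′} p⊆p′ q⊆q′ = ∪-least (⊆-trans p⊆p′ (p⊆p∪q q′)) (⊆-trans q⊆q′ (q⊆p∪q _ q′))

─-monoˡ : ∀ {n} {p q : Subset n} (r : Subset n) → p ⊆ q → p ─ r ⊆ q ─ r
─-monoˡ {p = p} r p⊆q x∈ with x∈p─q⁻ p r x∈
... | x∈p , x∉r = x∈p∧x∉q⇒x∈p─q (p⊆q x∈p) x∉r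

p⊆p─q∪q : ∀ {n} (p q : Subset n) → p ⊆ (p ─ q) ∪ q
p⊆p─q∪q p q {x} x∈p with x ∈? q
... | yes x∈q = q⊆p∪q (p ─ q) q x∈q
... | no x∉q = p⊆p∪q q (x∈p∧x∉q⇒x∈p─q x∈p x∉q)

∣p∪q∣≤∣p∣+∣q∣ : ∀ {n} (p q : Subset n) → ∣ p ∪ q ∣ ≤ ∣ p ∣ + ∣ q ∣
∣p∪q∣≤∣p∣+∣q∣ [] [] = z≤n
∣p∪q∣≤∣p∣+∣q∣ (inside ∷ p) (t ∷ q) =
  s≤s (≤-trans (∣p∪q∣≤∣p∣+∣q∣ p q) (+-monoʳ-≤ ∣ p ∣ (∣p∣≤∣x∷p∣ t q)))
∣p∪q∣≤∣p∣+∣q∣ (outside ∷ p) (inside ∷ q) rewrite +-suc ∣ p ∣ ∣ q ∣ = s≤s (∣p∪q∣≤∣p∣+∣q∣ p q)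
∣p∪q∣≤∣p∣+∣q∣ (outside ∷ p) (outside ∷ q) = ∣p∪q∣≤∣p∣+∣q∣ p q

q⊆p⊎∣p∣<∣p∪q∣ : ∀ {n} (p q : Subset n) → q ⊆ p ⊎ ∣ p ∣ < ∣ p ∪ q ∣
q⊆p⊎∣p∣<∣p∪q∣ [] [] = inj₁ (λ ())
q⊆p⊎∣p∣<∣p∪q∣ (s ∷ p) (t ∷ q) with q⊆p⊎∣p∣<∣p∪q∣ p q
q⊆p⊎∣p∣<∣p∪q∣ (inside ∷ p) (t ∷ q) | inj₂ lt = inj₂ (s≤s lt)
q⊆p⊎∣p∣<∣p∪q∣ (outside ∷ p) (inside ∷ q) | inj₂ lt = inj₂ (m≤n⇒m≤1+n lt)
q⊆p⊎∣p∣<∣p∪q∣ (outside ∷ p) (outside ∷ q) | inj₂ lt = inj₂ lt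
q⊆p⊎∣p∣<∣p∪q∣ (s ∷ p) (outside ∷ q) | inj₁ q⊆p = inj₁ (out⊆ q⊆p)
q⊆p⊎∣p∣<∣p∪q∣ (inside ∷ p) (inside ∷ q) | inj₁ q⊆p = inj₁ (in⊆in q⊆p)
q⊆p⊎∣p∣<∣p∪q∣ (outside ∷ p) (inside ∷ q) | inj₁ _ = inj₂ (s≤s (∣p∣≤∣p∪q∣ p q))

∣⊥∣≤ : ∀ n m → ∣ ⊥ {n} ∣ ≤ m
∣⊥∣≤ n m = subst (_≤ m) (sym (∣⊥∣≡0 n)) z≤n

∣p∣≡0⇒p⊆q : ∀ {n} (p q : Subset n) → ∣ p ∣ ≡ 0 → p ⊆ q
∣p∣≡0⇒p⊆q (outside ∷ p) (_ ∷ q) eq = out⊆ (∣p∣≡0⇒p⊆q p q eq)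

p⊆C⇒∣p∪C∣≤k : ∀ {n k} (p : Subset n) (C : SizedSet n k) → p ⊆ proj₁ C → ∣ p ∪ proj₁ C ∣ ≤ k
p⊆C⇒∣p∪C∣≤k p (C , ∣C∣≡k) p⊆C = subst (∣ p ∪ C ∣ ≤_) ∣C∣≡k (p⊆q⇒∣p∣≤∣q∣ (∪-least p⊆C ⊆-refl))

extend : ∀ {n} k (p : Subset n) → ∣ p ∣ ≤ k → k ≤ n → Σ (SizedSet n k) (λ q → p ⊆ proj₁ q)
extend zero [] _ _ = ([] , refl) , λ ()
extend zero (inside ∷ p) () _
extend (suc k) (inside ∷ p) (s≤s ∣p∣≤k) (s≤s k≤n) with extend k p ∣p∣≤k k≤n
... | (q , ∣q∣≡k) , p⊆q = (inside ∷ q , cong suc ∣q∣≡k) , in⊆in p⊆q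
extend {suc n} k (outside ∷ p) ∣p∣≤k k≤1+n with k ≤? n
... | yes k≤n with extend k p ∣p∣≤k k≤n
...   | (q , ∣q∣≡k) , p⊆q = (outside ∷ q , ∣q∣≡k) , out⊆ p⊆q
extend {suc n} zero (outside ∷ p) _ _ | no k≰n = contradiction z≤n k≰n
extend {suc n} (suc k) (outside ∷ p) _ (s≤s k≤n) | no 1+k≰n
  with extend k p (≤-trans (∣p∣≤n p) (≤-pred (≰⇒> 1+k≰n))) k≤n
... | (q , ∣q∣≡k) , p⊆q = (inside ∷ q , cong suc ∣q∣≡k) , out⊆ p⊆q

take : ∀ {n} → ℕ → Subset n → Subset n
take d [] = []
take d (outside ∷ p) = outside ∷ take d p
take zero (inside ∷ p) = outside ∷ take zero p
take (suc d) (inside ∷ p) = inside ∷ take d p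

take⊆ : ∀ {n} d (p : Subset n) → take d p ⊆ p
take⊆ d (outside ∷ p) = out⊆ (take⊆ d p)
take⊆ zero (inside ∷ p) = out⊆ (take⊆ zero p)
take⊆ (suc d) (inside ∷ p) = in⊆in (take⊆ d p)

∣take∣≤ : ∀ {n} d (p : Subset n) → ∣ take d p ∣ ≤ d
∣take∣≤ d [] = z≤n
∣take∣≤ d (outside ∷ p) = ∣take∣≤ d p
∣take∣≤ zero (inside ∷ p) = ∣take∣≤ zero p
∣take∣≤ (suc d) (inside ∷ p) = s≤s (∣take∣≤ d p)

∣p─take∣≡∣p∣∸d : ∀ {n} d (p : Subset n) → ∣ p ─ take d p ∣ ≡ ∣ p ∣ ∸ d
∣p─take∣≡∣p∣∸d zero [] = refl
∣p─take∣≡∣p∣∸d (suc d) [] = refl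
∣p─take∣≡∣p∣∸d d (outside ∷ p) = ∣p─take∣≡∣p∣∸d d p
∣p─take∣≡∣p∣∸d zero (inside ∷ p) = cong suc (∣p─take∣≡∣p∣∸d zero p)
∣p─take∣≡∣p∣∸d (suc d) (inside ∷ p) = ∣p─take∣≡∣p∣∸d d p

-- The i-th set is p without the i-th of m consecutive blocks of (at most) d elements.
dropBlock : ∀ {n} → ℕ → (m : ℕ) → Subset n → Fin m → Subset n
dropBlock d (suc m) p zero = p ─ take d p
dropBlock d (suc m) p (suc i) = dropBlock d m (p ─ take d p) i ∪ take d p

-- Pigeonhole: q meets fewer than m blocks, so one of the m sets keeps all of q.
⊆-dropBlock : ∀ {n} d m (p q : Subset n) → q ⊆ p → ∣ q ∣ < m → ∃[ i ] q ⊆ dropBlock d m p i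
⊆-dropBlock d (suc m) p q q⊆p ∣q∣<1+m with nonempty? (q ∩ take d p)
... | no q∩block≡∅ =
  zero , λ x∈q → x∈p∧x∉q⇒x∈p─q (q⊆p x∈q) (λ x∈block → q∩block≡∅ (_ , x∈p∩q⁺ (x∈q , x∈block)))
... | yes q∩block≢∅ =
  let i , q─block⊆ = ⊆-dropBlock d m (p ─ take d p) (q ─ take d p) (─-monoˡ (take d p) q⊆p)
                       (≤-trans (p∩q≢∅⇒∣p─q∣<∣p∣ q (take d p) q∩block≢∅) (≤-pred ∣q∣<1+m))
  in suc i , ⊆-trans (p⊆p─q∪q q (take d p)) (∪-mono q─block⊆ ⊆-refl)

∣p─take∣≤ : ∀ {n} d c (p : Subset n) → ∣ p ∣ ≤ d + c → ∣ p ─ take d p ∣ ≤ c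
∣p─take∣≤ d c p ∣p∣≤d+c = subst (_≤ c) (sym (∣p─take∣≡∣p∣∸d d p)) (m≤n+o⇒m∸n≤o ∣ p ∣ d ∣p∣≤d+c)

∣dropBlock∣≤ : ∀ {n} d m e (p : Subset n) → ∣ p ∣ ≤ suc m * d + e →
               ∀ i → ∣ dropBlock d (suc m) p i ∣ ≤ m * d + e
∣dropBlock∣≤ d m e p ∣p∣≤ zero =
  ∣p─take∣≤ d (m * d + e) p (subst (∣ p ∣ ≤_) (+-assoc d (m * d) e) ∣p∣≤)
∣dropBlock∣≤ d (suc m) e p ∣p∣≤ (suc i) = begin
  ∣ rest ∪ block ∣     ≤⟨ ∣p∪q∣≤∣p∣+∣q∣ rest block ⟩
  ∣ rest ∣ + ∣ block ∣ ≤⟨ +-mono-≤ ∣rest∣≤ (∣take∣≤ d p) ⟩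
  m * d + e + d        ≡⟨ +-comm (m * d + e) d ⟩
  d + (m * d + e)      ≡⟨ +-assoc d (m * d) e ⟨
  suc m * d + e        ∎
  where
  open ≤-Reasoning
  block = take d p
  rest = dropBlock d (suc m) (p ─ block) i
  ∣rest∣≤ : ∣ rest ∣ ≤ m * d + e
  ∣rest∣≤ = ∣dropBlock∣≤ d m e (p ─ block)
    (∣p─take∣≤ d (suc m * d + e) p (subst (∣ p ∣ ≤_) (+-assoc d (suc m * d) e) ∣p∣≤)) i

prodFin≤1 : ∀ m (f : Fin m → ℕ) → (∀ i → f i ≤ 1) → prodFin m f ≤ 1
prodFin≤1 zero f f≤1 = ≤-refl
prodFin≤1 (suc m) f f≤1 = *-mono-≤ (f≤1 zero) (prodFin≤1 m (λ i → f (suc i)) (λ i → f≤1 (suc i)))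

prodFin-zero : ∀ m (f : Fin m → ℕ) i → f i ≡ 0 → prodFin m f ≡ 0
prodFin-zero (suc m) f zero fi≡0 rewrite fi≡0 = refl
prodFin-zero (suc m) f (suc i) fi≡0
  rewrite prodFin-zero m (λ j → f (suc j)) i fi≡0 = *-zeroʳ (f zero)

notIn≤1 : ∀ {N l k} (Q : Query N l) (C : Cache N k) → notIn Q C ≤ 1
notIn≤1 Q C with proj₁ Q ⊆? proj₁ C
... | yes _ = z≤n
... | no _ = ≤-refl

notIn-hit : ∀ {N l k} (Q : Query N l) (C : Cache N k) → proj₁ Q ⊆ proj₁ C → notIn Q C ≡ 0
notIn-hit Q C Q⊆C rewrite dec-true (proj₁ Q ⊆? proj₁ C) Q⊆C = refl

cost≤1 : ∀ {N l k m} (C : Config N k m) (Q : Query N l) → cost C Q ≤ 1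
cost≤1 {m = m} C Q = prodFin≤1 m _ (λ i → notIn≤1 Q (C i))

cost-hit : ∀ {N l k m} (C : Config N k m) (Q : Query N l) i → proj₁ Q ⊆ proj₁ (C i) → cost C Q ≡ 0
cost-hit {m = m} C Q i Q⊆Ci = prodFin-zero m _ i (notIn-hit Q (C i) Q⊆Ci)

cost≤∣Q∣ : ∀ {N l k m} (C : Config N k (suc m)) (Q : Query N l) → cost C Q ≤ ∣ proj₁ Q ∣
cost≤∣Q∣ C Q with ∣ proj₁ Q ∣ in ∣Q∣≡
... | zero = ≤-reflexive (cost-hit C Q zero (∣p∣≡0⇒p⊆q (proj₁ Q) (proj₁ (C zero)) ∣Q∣≡))
... | suc _ = ≤-trans (cost≤1 C Q) (s≤s z≤n)

-- ⌊k / l⌋, with 0 for l = 0 (where the threshold property holds vacuously).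
blockSize : ℕ → ℕ → ℕ
blockSize k zero = 0
blockSize k (suc l) = k / suc l

*-blockSize≤ : ∀ k l → l * blockSize k l ≤ k
*-blockSize≤ k zero = z≤n
*-blockSize≤ k (suc l) = subst (_≤ k) (*-comm (k / suc l) (suc l)) (m/n*n≤m k (suc l))

blockSize-threshold : ∀ k l J → blockSize k l < J * l → k + blockSize k l ≤ (l * l + l) * J
blockSize-threshold k zero J d<J*0 = contradiction (subst (0 <_) (*-zeroʳ J) d<J*0) λ ()
blockSize-threshold k (suc l) J d<J*l′ = <⇒≤ $ begin-strict
  k + d                       ≡⟨ cong (_+ d) (m≡m%n+[m/n]*n k (suc l)) ⟩
  k % suc l + d * suc l + d   <⟨ +-monoˡ-< d (+-monoˡ-< (d * suc l) (m%n<n k (suc l))) ⟩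
  suc l + d * suc l + d       ≤⟨ n≤1+n _ ⟩
  suc (suc l + d * suc l + d) ≡⟨ expand d l ⟩
  suc d * suc (suc l)         ≤⟨ *-monoˡ-≤ (suc (suc l)) d<J*l′ ⟩
  J * suc l * suc (suc l)     ≡⟨ reorder J l ⟩
  (suc l * suc l + suc l) * J ∎
  where
  open ≤-Reasoning
  d = k / suc l
  expand : ∀ d l → suc (suc l + d * suc l + d) ≡ suc d * suc (suc l)
  expand = solve-∀
  reorder : ∀ J l → J * suc l * suc (suc l) ≡ (suc l * suc l + suc l) * J
  reorder = solve-∀

record OptStep {N k l} (S : Subset N) (Q : Query N l) (σ : List (Query N l)) (n j : ℕ) : Set where
  field
    cache′ : Cache N k
    n′ j′ : ℕ
    run′ : SingleRun cache′ σ n′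
    n+j≡n′+j′ : n + j ≡ n′ + j′
    Q⊆cache′ : proj₁ Q ⊆ proj₁ cache′
    footprint : ∣ (S ∪ proj₁ Q) ∪ proj₁ cache′ ∣ ≤ j′ * l + k

-- A miss lets the single cache insert only Q, so S ∪ D grows by at most l pages per miss.
optStep : ∀ {N k l} {S : Subset N} {D : Cache N k} {Q : Query N l} {σ n} j →
          SingleRun D (Q ∷ σ) n → ∣ S ∪ proj₁ D ∣ ≤ j * l + k → OptStep S Q σ n j
optStep {S = S} {D} j (hit Q⊆D run) footprint = record
  { cache′ = D ; n′ = _ ; j′ = j ; run′ = run ; n+j≡n′+j′ = refl ; Q⊆cache′ = Q⊆D
  ; footprint = ≤-trans (p⊆q⇒∣p∣≤∣q∣ (∪-least (∪-mono ⊆-refl Q⊆D) (q⊆p∪q S (proj₁ D)))) footprint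
  }
optStep {l = l} {S} {D} {Q} j (miss {D' = D′} {n = n′} _ Q⊆D′ D′⊆D∪Q run) footprint = record
  { cache′ = D′ ; n′ = n′ ; j′ = suc j ; run′ = run ; n+j≡n′+j′ = sym (+-suc n′ j) ; Q⊆cache′ = Q⊆D′
  ; footprint = begin
      ∣ (S ∪ proj₁ Q) ∪ proj₁ D′ ∣  ≤⟨ p⊆q⇒∣p∣≤∣q∣ grown⊆ ⟩
      ∣ (S ∪ proj₁ D) ∪ proj₁ Q ∣   ≤⟨ ∣p∪q∣≤∣p∣+∣q∣ (S ∪ proj₁ D) (proj₁ Q) ⟩
      ∣ S ∪ proj₁ D ∣ + ∣ proj₁ Q ∣ ≤⟨ +-mono-≤ footprint (≤-reflexive (proj₂ Q)) ⟩
      j * l + _ + l                 ≡⟨ add-l j l _ ⟩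
      suc j * l + _                 ∎
  }
  where
  open ≤-Reasoning
  grown⊆ : (S ∪ proj₁ Q) ∪ proj₁ D′ ⊆ (S ∪ proj₁ D) ∪ proj₁ Q
  grown⊆ = ∪-least (∪-mono (p⊆p∪q (proj₁ D)) ⊆-refl)
                   (⊆-trans D′⊆D∪Q (∪-mono (q⊆p∪q S (proj₁ D)) ⊆-refl))
  add-l : ∀ j l k → j * l + k + l ≡ suc j * l + k
  add-l = solve-∀

module PhaseAlgorithm (N k l : ℕ) (l≤k : l ≤ k) (k≤N : k ≤ N) where

  d W R : ℕ
  d = blockSize k l
  W = k + d
  R = l * l + l

  -- Sets larger than k never reach toCache (see ∣dropBlock∣≤); they get an arbitrary cache.
  toCache : Subset N → Cache N k
  toCache p with ∣ p ∣ ≤? k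
  ... | yes ∣p∣≤k = proj₁ (extend k p ∣p∣≤k k≤N)
  ... | no _ = proj₁ (extend k ⊥ (∣⊥∣≤ N k) k≤N)

  ⊆-toCache : ∀ p → ∣ p ∣ ≤ k → p ⊆ proj₁ (toCache p)
  ⊆-toCache p ∣p∣≤k with ∣ p ∣ ≤? k
  ... | yes ∣p∣≤k′ = proj₂ (extend k p ∣p∣≤k′ k≤N)
  ... | no ∣p∣≰k = contradiction ∣p∣≤k ∣p∣≰k

  caches : Subset N → Config N k (suc l)
  caches S i = toCache (dropBlock d (suc l) S i)

  caches-hit : ∀ S (Q : Query N l) → ∣ S ∣ ≤ W → proj₁ Q ⊆ S → cost (caches S) Q ≡ 0
  caches-hit S Q ∣S∣≤W Q⊆S =
    let i , Q⊆block = ⊆-dropBlock d (suc l) S (proj₁ Q) Q⊆S (s≤s (≤-reflexive (proj₂ Q)))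
    in cost-hit (caches S) Q i (⊆-trans Q⊆block (⊆-toCache _ (block≤k i)))
    where
    open ≤-Reasoning
    k≡ : l * d + (k ∸ l * d) ≡ k
    k≡ = m+[n∸m]≡n (*-blockSize≤ k l)
    ∣S∣≤ : ∣ S ∣ ≤ suc l * d + (k ∸ l * d)
    ∣S∣≤ = begin
      ∣ S ∣                     ≤⟨ ∣S∣≤W ⟩
      k + d                     ≡⟨ +-comm k d ⟩
      d + k                     ≡⟨ cong (d +_) k≡ ⟨
      d + (l * d + (k ∸ l * d)) ≡⟨ +-assoc d (l * d) _ ⟨
      suc l * d + (k ∸ l * d)   ∎
    block≤k : ∀ i → ∣ dropBlock d (suc l) S i ∣ ≤ k
    block≤k i = subst (∣ dropBlock d (suc l) S i ∣ ≤_) k≡ (∣dropBlock∣≤ d l (k ∸ l * d) S ∣S∣≤ i)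

  nextPhase : Subset N → Query N l → Subset N
  nextPhase S Q with ∣ S ∪ proj₁ Q ∣ ≤? W
  ... | yes _ = S ∪ proj₁ Q
  ... | no _ = proj₁ Q

  ∣Q∣≤W : (Q : Query N l) → ∣ proj₁ Q ∣ ≤ W
  ∣Q∣≤W Q = ≤-trans (≤-reflexive (proj₂ Q)) (≤-trans l≤k (m≤m+n k d))

  cost+≤ : ∀ S (Q : Query N l) a → ∣ S ∣ ≤ W → a ≤ ∣ S ∣ → cost (caches S) Q + a ≤ ∣ S ∪ proj₁ Q ∣
  cost+≤ S Q a ∣S∣≤W a≤∣S∣ with q⊆p⊎∣p∣<∣p∪q∣ S (proj₁ Q)
  ... | inj₁ Q⊆S rewrite caches-hit S Q ∣S∣≤W Q⊆S = ≤-trans a≤∣S∣ (∣p∣≤∣p∪q∣ S (proj₁ Q))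
  ... | inj₂ ∣S∣<∣S∪Q∣ = ≤-trans (+-mono-≤ (cost≤1 (caches S) Q) a≤∣S∣) ∣S∣<∣S∪Q∣

  data PhaseStep (S : Subset N) (Q : Query N l) : Subset N → Set where
    continue : ∣ S ∪ proj₁ Q ∣ ≤ W → PhaseStep S Q (S ∪ proj₁ Q)
    restart : W < ∣ S ∪ proj₁ Q ∣ → PhaseStep S Q (proj₁ Q)

  phaseStep : ∀ S Q → PhaseStep S Q (nextPhase S Q)
  phaseStep S Q with ∣ S ∪ proj₁ Q ∣ ≤? W
  ... | yes fits = continue fits
  ... | no overflow = restart (≰⇒> overflow)

  phaseOf : List (Query N l) → Subset N
  phaseOf [] = ⊥
  phaseOf (Q ∷ hist) = nextPhase (phaseOf hist) Q

  algorithm : OnlineAlg N l k (suc l)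
  algorithm hist = caches (phaseOf hist)

  costFrom : Subset N → List (Query N l) → ℕ
  costFrom S [] = 0
  costFrom S (Q ∷ σ) = cost (caches S) Q + costFrom (nextPhase S Q) σ

  algCostFrom≡costFrom : ∀ hist σ → algCostFrom algorithm hist σ ≡ costFrom (phaseOf hist) σ
  algCostFrom≡costFrom hist [] = refl
  algCostFrom≡costFrom hist (Q ∷ σ) =
    cong (cost (algorithm hist) Q +_) (algCostFrom≡costFrom (Q ∷ hist) σ)

  overflow⇒W≤R*j : ∀ S Q (D : Cache N k) j → W < ∣ S ∪ Q ∣ → ∣ (S ∪ Q) ∪ proj₁ D ∣ ≤ j * l + k →
                   W ≤ R * j
  overflow⇒W≤R*j S Q D j overflow footprint =
    blockSize-threshold k l j (+-cancelˡ-< k d (j * l) k+d<k+j*l)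
    where
    open ≤-Reasoning
    k+d<k+j*l : k + d < k + j * l
    k+d<k+j*l = begin-strict
      k + d                 <⟨ overflow ⟩
      ∣ S ∪ Q ∣             ≤⟨ ∣p∣≤∣p∪q∣ (S ∪ Q) (proj₁ D) ⟩
      ∣ (S ∪ Q) ∪ proj₁ D ∣ ≤⟨ footprint ⟩
      j * l + k             ≡⟨ +-comm (j * l) k ⟩
      k + j * l             ∎

  -- a bounds the misses of the algorithm in the current phase, j those of the single cache.
  amortised : ∀ σ S (D : Cache N k) n j a → SingleRun D σ n →
              ∣ S ∣ ≤ W → a ≤ ∣ S ∣ → ∣ S ∪ proj₁ D ∣ ≤ j * l + k →
              costFrom S σ + a ≤ R * (n + j) + W
  amortised [] S D .0 j a done ∣S∣≤W a≤∣S∣ _ = ≤-trans a≤∣S∣ (≤-trans ∣S∣≤W (m≤n+m W (R * (0 + j))))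
  amortised (Q ∷ σ) S D n j a run ∣S∣≤W a≤∣S∣ footprint
    with optStep {S = S} j run footprint | nextPhase S Q | phaseStep S Q
  ... | opt | _ | continue fits =
    subst₂ _≤_ (regroup x _ a) (cong (λ t → R * t + W) (sym n+j≡n′+j′))
      (amortised σ (S ∪ proj₁ Q) cache′ n′ j′ (x + a) run′ fits
        (cost+≤ S Q a ∣S∣≤W a≤∣S∣) footprint′)
    where
    open OptStep opt renaming (footprint to footprint′)
    x = cost (caches S) Q
    regroup : ∀ x F a → F + (x + a) ≡ x + F + a
    regroup = solve-∀
  ... | opt | _ | restart overflow =
    subst (λ t → x + costFrom (proj₁ Q) σ + a ≤ R * t + W) (sym n+j≡n′+j′)
      (close-phase
        (amortised σ (proj₁ Q) cache′ n′ 0 x run′ (∣Q∣≤W Q) (cost≤∣Q∣ (caches S) Q)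
          (p⊆C⇒∣p∪C∣≤k (proj₁ Q) cache′ Q⊆cache′))
        (≤-trans a≤∣S∣ (≤-trans ∣S∣≤W (overflow⇒W≤R*j S (proj₁ Q) cache′ j′ overflow footprint′))))
    where
    open OptStep opt renaming (footprint to footprint′)
    x = cost (caches S) Q
    close-phase : costFrom (proj₁ Q) σ + x ≤ R * (n′ + 0) + W → a ≤ R * j′ →
                  x + costFrom (proj₁ Q) σ + a ≤ R * (n′ + j′) + W
    close-phase F+x≤ a≤ = subst₂ _≤_ (lhs x _ a) (rhs R n′ W j′) (+-mono-≤ F+x≤ a≤)
      where
      lhs : ∀ x F a → F + x + a ≡ x + F + a
      lhs = solve-∀
      rhs : ∀ R n W j → R * (n + 0) + W + R * j ≡ R * (n + j) + W
      rhs = solve-∀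

theorem5p1 : (N k l : ℕ) → l ≤ k → k ≤ N →
    Σ (OnlineAlg N l k (suc l)) (λ A → Σ ℕ (λ c →
      (σ : List (Query N l)) (D : Cache N k) (n : ℕ) → SingleRun D σ n →
        algCost A σ ≤ (l * l + l) * n + c))
theorem5p1 N k l l≤k k≤N = algorithm , W , competitive
  where
  open PhaseAlgorithm N k l l≤k k≤N
  open ≤-Reasoning
  competitive : ∀ σ (D : Cache N k) n → SingleRun D σ n → algCost algorithm σ ≤ R * n + W
  competitive σ D n run = begin
    algCost algorithm σ ≡⟨ algCostFrom≡costFrom [] σ ⟩
    costFrom ⊥ σ        ≡⟨ +-identityʳ _ ⟨
    costFrom ⊥ σ + 0    ≤⟨ amortised σ ⊥ D n 0 0 run (∣⊥∣≤ N W) z≤n (p⊆C⇒∣p∪C∣≤k ⊥ D ⊥⊆) ⟩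
    R * (n + 0) + W     ≡⟨ cong (λ t → R * t + W) (+-identityʳ n) ⟩
    R * n + W           ∎
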